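{- Let $G$ be a finite simple graph. Then $\gamma_P(G)=1$ if and only if $G$ is a graph of $k$ internally parallel paths for some $k$.
   Context: Power domination: for a set $S$, first color blue all vertices of $S$ and all their neighbors; then repeatedly, whenever a blue vertex has exactly one non-blue neighbor, color that neighbor blue. $S$ is a power dominating set if eventually all vertices are blue; $\gamma_P(G)$ is the minimum size of a power dominating set. For a path $P: a_1,a_2,\ldots,a_m$ and a vertex $a_i$ of $P$, ${}^{a_i}P$ denotes the subpath $a_{i+1},\ldots,a_m$. $G$ is a graph of $k$ internally parallel paths if there is a vertex $x\in V(G)$ and $k$ paths $Q_1,\ldots,Q_k$, each an induced path of $G$ having $x$ as an end-vertex, with $V(Q_i)\cap V(Q_j)=\{x\}$ for $i\ne j$ and $V(G)=\bigcup_{i=1}^k V(Q_i)$ (so $E(G)$ consists of the path edges together with any number of edges joining vertices of different paths), such that the following holds: for every choice of $\ell\le k$ vertices $x_{i_1}\in V(Q_{i_1}),\ldots,x_{i_\ell}\in V(Q_{i_\ell})$ lying on pairwise distinct paths, none of which is an end-vertex of its path, there exists $x'\in\{x_{i_1},\ldots,x_{i_\ell}\}$ with exactly one neighbor in $Y=V({}^{x_{i_1}}Q_{i_1})\cup\cdots\cup V({}^{x_{i_\ell}}Q_{i_\ell})$, where each $Q_{i}$ is traversed starting from $x$. -}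

module Defs where

open import Data.Nat using (ℕ; zero; suc; _<_; _≤_)
open import Data.Fin using (Fin; toℕ) renaming (zero to fzero)
open import Data.Fin.Subset using (Subset; _∈_; ∣_∣)
open import Data.Bool using (Bool; true; false)
open import Data.Maybe using (Maybe; just; nothing)
open import Data.Product using (Σ; _×_; ∃; ∃-syntax; _,_)
open import Data.Sum using (_⊎_)
open import Relation.Binary.PropositionalEquality using (_≡_; _≢_)

record Graph : Set where
  field
    n       : ℕ
    adj     : Fin n → Fin n → Bool
    symm    : ∀ u v → adj u v ≡ adj v u
    irrefl  : ∀ v → adj v v ≡ false

module _ (G : Graph) where
  open Graph G

  E : Fin n → Fin n → Set
  E u v = adj u v ≡ true

  -- Initially S and all neighbours of S are blue; a blue vertex u all of
  -- whose neighbours other than v are blue forces its neighbour v.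
  -- (The final blue set is the least set closed under these rules.)
  data Blue (S : Subset n) : Fin n → Set where
    inS   : ∀ {v} → v ∈ S → Blue S v
    nbr   : ∀ {u v} → u ∈ S → E u v → Blue S v
    force : ∀ {u v} → Blue S u → E u v →
            (∀ w → E u w → w ≢ v → Blue S w) → Blue S v

  IsPowerDominating : Subset n → Set
  IsPowerDominating S = ∀ v → Blue S v

  PowerDomNumberIs : ℕ → Set
  PowerDomNumberIs k =
    (Σ (Subset n) λ S → IsPowerDominating S × ∣ S ∣ ≡ k) ×
    (∀ S → IsPowerDominating S → k ≤ ∣ S ∣)

  record InternallyParallelPaths (k : ℕ) : Set where
    field
      x     : Fin n
      m     : Fin k → ℕ
      Q     : (i : Fin k) → Fin (suc (m i)) → Fin n
      start : ∀ i → Q i fzero ≡ x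
      simple  : ∀ i a b → Q i a ≡ Q i b → a ≡ b
      induced : ∀ i a b →
                (E (Q i a) (Q i b) → (toℕ b ≡ suc (toℕ a) ⊎ toℕ a ≡ suc (toℕ b))) ×
                ((toℕ b ≡ suc (toℕ a) ⊎ toℕ a ≡ suc (toℕ b)) → E (Q i a) (Q i b))
      disjoint : ∀ i j a b → i ≢ j → Q i a ≡ Q j b → Q i a ≡ x
      cover : ∀ v → ∃[ i ] ∃[ a ] Q i a ≡ v
      -- Main condition.  A choice of ℓ ≥ 1 vertices on pairwise distinct
      -- paths is a partial function sel assigning to some paths i an
      -- internal position p (0 < p < m i).
      parallel :
        (sel : (i : Fin k) → Maybe (Fin (suc (m i)))) →
        (∃[ i ] ∃[ p ] sel i ≡ just p) →
        (∀ i p → sel i ≡ just p → 0 < toℕ p × toℕ p < m i) →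
        let Y : Fin n → Set
            Y y = ∃[ i ] ∃[ p ] ∃[ q ] (sel i ≡ just p × toℕ p < toℕ q × Q i q ≡ y)
        in ∃[ i ] ∃[ p ] (sel i ≡ just p ×
             (∃[ y ] (Y y × E (Q i p) y × (∀ z → Y z → E (Q i p) z → z ≡ y))))

-- If {x} power dominates G, record for every vertex the step at which it
-- turned blue and the vertex that forced it.  The forcing chains starting at
-- the neighbours of x are induced paths that meet only at x and cover G, since
-- times increase along them and a forcing vertex has no later neighbour other
-- than the one it forces.  Given internal vertices on several of these paths,
-- the one whose successor was forced earliest has that successor as its only
-- neighbour further out on the chosen paths: all its other neighbours turned
-- blue before.  Conversely, starting from {x} and growing a blue prefix of each
-- path, the parallel-paths condition applied to the ends of the unfinished
-- prefixes always yields an end that can force its successor.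

module Submission where

open import Defs
open import Data.Nat using (ℕ; zero; suc; _<_; _≤_; z≤n; s≤s; _∸_; _+_; _⊓_; _<?_; _≤?_)
open import Data.Nat.Properties
open import Data.Nat.Induction using (<-wellFounded)
open import Induction.WellFounded using (Acc; acc)
open import Data.Fin using (Fin; toℕ; fromℕ<) renaming (zero to fzero; suc to fsuc)
open import Data.Fin.Properties using (toℕ-injective; toℕ-fromℕ<; toℕ<n; any?; all?) renaming (_≟_ to _≟F_)
open import Data.Fin.Subset using (Subset; _∈_; ∣_∣; ⁅_⁆; ⊥)
open import Data.Fin.Subset.Properties using (x∈⁅x⁆; x∈⁅y⁆⇒x≡y; ∣⁅x⁆∣≡1; p⊆q⇒∣p∣≤∣q∣; ∣⊥∣≡0; p⊂q⇒∣p∣<∣q∣; nonempty?)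
open import Data.Vec.Functional using (updateAt)
open import Data.Vec.Functional.Properties using (updateAt-updates; updateAt-minimal)
open import Data.Bool using (Bool; true; false; if_then_else_)
open import Data.Bool.Properties using () renaming (_≟_ to _≟B_)
open import Relation.Nullary.Decidable using (_×-dec_; _→-dec_; ¬?)
open import Data.Maybe using (Maybe; just; nothing; maybe)
open import Data.Product
open import Data.Sum using (_⊎_; inj₁; inj₂)
open import Data.Empty using (⊥-elim)
open import Function using (_∘_; const)
open import Relation.Nullary
open import Relation.Unary using (Decidable)
open import Relation.Binary.PropositionalEquality
open import Relation.Binary.Definitions using (tri<; tri≈; tri>)

∑ : ∀ {k} → (Fin k → ℕ) → ℕ
∑ {zero}  f = 0
∑ {suc k} f = f fzero + ∑ (f ∘ fsuc)

∑-mono-≤ : ∀ {k} {f g : Fin k → ℕ} → (∀ i → f i ≤ g i) → ∑ f ≤ ∑ g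
∑-mono-≤ {zero}  f≤g = z≤n
∑-mono-≤ {suc k} f≤g = +-mono-≤ (f≤g fzero) (∑-mono-≤ (f≤g ∘ fsuc))

∑-mono-< : ∀ {k} {f g : Fin k → ℕ} → (∀ i → f i ≤ g i) → ∀ i → f i < g i → ∑ f < ∑ g
∑-mono-< f≤g fzero    f<g = +-mono-<-≤ f<g (∑-mono-≤ (f≤g ∘ fsuc))
∑-mono-< f≤g (fsuc i) f<g = +-mono-≤-< (f≤g fzero) (∑-mono-< (f≤g ∘ fsuc) i f<g)

module _ {A : Set} {P : A → Set} (μ : A → ℕ) (progress : ∀ a → P a ⊎ ∃[ a′ ] μ a′ < μ a) where

  ∃-by-descent : A → ∃ P
  ∃-by-descent a = go a (<-wellFounded (μ a))
    where
    go : ∀ a → Acc _<_ (μ a) → ∃ P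
    go a (acc rs) with progress a
    ... | inj₁ pa        = a , pa
    ... | inj₂ (a′ , lt) = go a′ (rs lt)

module _ (h : ℕ → ℕ) {L : ℕ} (step : ∀ a → a < L → h a < h (suc a)) where

  stepwise⇒<-mono : ∀ {a b} → a < b → b ≤ L → h a < h b
  stepwise⇒<-mono {a} {suc b} a<1+b 1+b≤L with m≤n⇒m<n∨m≡n (≤-pred a<1+b)
  ... | inj₁ a<b  = <-trans (stepwise⇒<-mono a<b (≤-trans (n≤1+n b) 1+b≤L)) (step b 1+b≤L)
  ... | inj₂ refl = step a 1+b≤L

  stepwise⇒≤-mono : ∀ {a b} → a ≤ b → b ≤ L → h a ≤ h b
  stepwise⇒≤-mono a≤b b≤L with m≤n⇒m<n∨m≡n a≤b
  ... | inj₁ a<b  = <⇒≤ (stepwise⇒<-mono a<b b≤L)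
  ... | inj₂ refl = ≤-refl

argmin : ∀ {k} {P : Fin k → Set} → Decidable P → (c : Fin k → ℕ) → ∃ P → ∃[ i ] (P i × ∀ j → P j → c i ≤ c j)
argmin {P = P} P? c i₀ with ∃-by-descent (c ∘ proj₁) improve i₀
  where
  improve : (iP : ∃ P) → (∀ j → P j → c (proj₁ iP) ≤ c j) ⊎ Σ[ jP ∈ ∃ P ] c (proj₁ jP) < c (proj₁ iP)
  improve (i , _) with any? (λ j → P? j ×-dec (c j <? c i))
  ... | yes (j , pⱼ , cⱼ<cᵢ) = inj₂ ((j , pⱼ) , cⱼ<cᵢ)
  ... | no  none             = inj₁ (λ j pⱼ → ≮⇒≥ (λ cⱼ<cᵢ → none (j , pⱼ , cⱼ<cᵢ)))
... | (i , pᵢ) , minimal = i , pᵢ , minimal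

∣S∣≡1⇒singleton : ∀ {n} (S : Subset n) → ∣ S ∣ ≡ 1 → ∃[ x ] (x ∈ S × ∀ y → y ∈ S → y ≡ x)
∣S∣≡1⇒singleton {n} S ∣S∣≡1 with nonempty? S
... | no empty = ⊥-elim (1+n≰n (begin
      1             ≡⟨ sym ∣S∣≡1 ⟩
      ∣ S ∣         ≤⟨ p⊆q⇒∣p∣≤∣q∣ {q = ⊥} (λ y∈S → ⊥-elim (empty (_ , y∈S))) ⟩
      ∣ ⊥ {n = n} ∣ ≡⟨ ∣⊥∣≡0 n ⟩
      0             ∎))
  where open ≤-Reasoning
... | yes (x , x∈S) = x , x∈S , unique
  where
  unique : ∀ y → y ∈ S → y ≡ x
  unique y y∈S with y ≟F x
  ... | yes y≡x = y≡x
  ... | no  y≢x = ⊥-elim (<-irrefl refl (subst₂ _<_ (∣⁅x⁆∣≡1 x) ∣S∣≡1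
          (p⊂q⇒∣p∣<∣q∣ ( (λ z∈⁅x⁆ → subst (_∈ S) (sym (x∈⁅y⁆⇒x≡y x z∈⁅x⁆)) x∈S)
                        , y , y∈S , y≢x ∘ x∈⁅y⁆⇒x≡y x))))

module _ (G : Graph) where
  open Graph G

  Blue⇒source : ∀ {S v} → Blue G S v → ∃[ u ] u ∈ S
  Blue⇒source (inS {v} v∈S)   = v , v∈S
  Blue⇒source (nbr {u} u∈S _) = u , u∈S
  Blue⇒source (force b _ _)   = Blue⇒source b

  powerDominating⇒∣S∣≥1 : Fin n → ∀ S → IsPowerDominating G S → 1 ≤ ∣ S ∣
  powerDominating⇒∣S∣≥1 v S pd with Blue⇒source (pd v)
  ... | u , u∈S = subst (_≤ ∣ S ∣) (∣⁅x⁆∣≡1 u)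
    (p⊆q⇒∣p∣≤∣q∣ (λ w∈⁅u⁆ → subst (_∈ S) (sym (x∈⁅y⁆⇒x≡y u w∈⁅u⁆)) u∈S))

module ParallelPaths⇒PowerDominating (G : Graph) {k : ℕ} (R : InternallyParallelPaths G k) where
  open Graph G
  open InternallyParallelPaths R

  record Frontier (b : Fin k → ℕ) : Set where
    field
      internal : ∀ i → 0 < m i → 0 < b i
      reached  : ∀ i (a : Fin (suc (m i))) → toℕ a ≤ b i → Blue G ⁅ x ⁆ (Q i a)

  remaining : (Fin k → ℕ) → ℕ
  remaining b = ∑ λ i → m i ∸ b i

  initialFrontier : Frontier (λ i → 1 ⊓ m i)
  initialFrontier = record
    { internal = λ i 0<m → ⊓-glb ≤-refl 0<m
    ; reached  = reached₀ }
    where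
    reached₀ : ∀ i (a : Fin (suc (m i))) → toℕ a ≤ 1 ⊓ m i → Blue G ⁅ x ⁆ (Q i a)
    reached₀ i fzero _ = inS (subst (_∈ ⁅ x ⁆) (sym (start i)) (x∈⁅x⁆ x))
    reached₀ i (fsuc a) a≤ = nbr (x∈⁅x⁆ x) (subst (λ z → E G z (Q i (fsuc a))) (start i)
                               (proj₂ (induced i fzero (fsuc a)) (inj₁ (cong suc a≡0))))
      where
      a≡0 : toℕ a ≡ 0
      a≡0 = n≤0⇒n≡0 (≤-pred (≤-trans a≤ (m⊓n≤m 1 (m i))))

  module _ {b : Fin k → ℕ} (F : Frontier b) where
    open Frontier F

    frontierEnds : (i : Fin k) → Maybe (Fin (suc (m i)))
    frontierEnds i with b i <? m i
    ... | yes b<m = just (fromℕ< (m<n⇒m<1+n b<m))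
    ... | no  _   = nothing

    frontierEnds-just : ∀ {i p} → frontierEnds i ≡ just p → b i < m i × toℕ p ≡ b i
    frontierEnds-just {i} eq with b i <? m i
    frontierEnds-just refl | yes b<m = b<m , toℕ-fromℕ< _

    frontierEnds-unfinished : ∀ {i} → b i < m i → ∃[ p ] (frontierEnds i ≡ just p × toℕ p ≡ b i)
    frontierEnds-unfinished {i} b<m with b i <? m i
    ... | yes _   = _ , refl , toℕ-fromℕ< _
    ... | no  b≮m = ⊥-elim (b≮m b<m)

    frontierEnds-internal : ∀ i p → frontierEnds i ≡ just p → 0 < toℕ p × toℕ p < m i
    frontierEnds-internal i p eq with frontierEnds-just eq
    ... | b<m , p≡b = subst (λ c → 0 < c × c < m i) (sym p≡b) (internal i (≤-<-trans z≤n b<m) , b<m)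

    forceable : ∀ {i₀} → b i₀ < m i₀ →
                ∃[ i ] (b i < m i × ∀ a → toℕ a ≡ suc (b i) → Blue G ⁅ x ⁆ (Q i a))
    forceable b<m with frontierEnds-unfinished b<m
    ... | p₀ , sel₀ , _ with parallel frontierEnds (_ , p₀ , sel₀) frontierEnds-internal
    ...   | i , p , selᵢ , y , _ , _ , unique with frontierEnds-just selᵢ
    ...     | bᵢ<m , p≡b = i , bᵢ<m , blueNext
      where
      blueNext : ∀ a → toℕ a ≡ suc (b i) → Blue G ⁅ x ⁆ (Q i a)
      blueNext a a≡b+1 = force (reached i p (≤-reflexive p≡b)) Eₐ others
        where
        p<a : toℕ p < toℕ a
        p<a = ≤-reflexive (trans (cong suc p≡b) (sym a≡b+1))
        Eₐ : E G (Q i p) (Q i a)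
        Eₐ = proj₂ (induced i p a) (inj₁ (trans a≡b+1 (cong suc (sym p≡b))))
        a≡y : Q i a ≡ y
        a≡y = unique (Q i a) (i , p , a , selᵢ , p<a , refl) Eₐ
        others : ∀ w → E G (Q i p) w → w ≢ Q i a → Blue G ⁅ x ⁆ w
        others w Ew w≢a with cover w
        ... | j , c , refl with toℕ c ≤? b j
        ...   | yes c≤b = reached j c c≤b
        ...   | no  c≰b with frontierEnds-unfinished (<-≤-trans (≰⇒> c≰b) (≤-pred (toℕ<n c)))
        ...     | q , selⱼ , q≡b =
          ⊥-elim (w≢a (trans (unique w (j , q , c , selⱼ , subst (_< toℕ c) (sym q≡b) (≰⇒> c≰b) , refl) Ew)
                             (sym a≡y)))

  advance : ∀ {b} → Frontier b → ∀ {i} → b i < m i →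
            (∀ a → toℕ a ≡ suc (b i) → Blue G ⁅ x ⁆ (Q i a)) → Frontier (updateAt b i suc)
  advance {b} F {i} b<m blueNext = record { internal = internal′ ; reached = reached′ }
    where
    open Frontier F
    internal′ : ∀ j → 0 < m j → 0 < updateAt b i suc j
    internal′ j 0<m with j ≟F i
    ... | yes refl rewrite updateAt-updates i {suc} b = s≤s z≤n
    ... | no  j≢i  rewrite updateAt-minimal j i {suc} b j≢i = internal j 0<m
    reached′ : ∀ j (a : Fin (suc (m j))) → toℕ a ≤ updateAt b i suc j → Blue G ⁅ x ⁆ (Q j a)
    reached′ j a a≤ with j ≟F i
    ... | no  j≢i  rewrite updateAt-minimal j i {suc} b j≢i = reached j a a≤
    ... | yes refl rewrite updateAt-updates i {suc} b with m≤n⇒m<n∨m≡n a≤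
    ...   | inj₁ a<b+1 = reached i a (≤-pred a<b+1)
    ...   | inj₂ a≡b+1 = blueNext a a≡b+1

  remaining-advance : ∀ b {i} → b i < m i → remaining (updateAt b i suc) < remaining b
  remaining-advance b {i} b<m = ∑-mono-< shrinks i (subst (λ c → m i ∸ c < m i ∸ b i)
                                  (sym (updateAt-updates i {suc} b)) (∸-monoʳ-< (n<1+n (b i)) b<m))
    where
    shrinks : ∀ j → m j ∸ updateAt b i suc j ≤ m j ∸ b j
    shrinks j with j ≟F i
    ... | yes refl rewrite updateAt-updates i {suc} b = ∸-monoʳ-≤ (m i) (n≤1+n (b i))
    ... | no  j≢i  rewrite updateAt-minimal j i {suc} b j≢i = ≤-refl

  Finished : Σ (Fin k → ℕ) Frontier → Set
  Finished (b , _) = ∀ i → m i ≤ b i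

  progress : ∀ bF → Finished bF ⊎ Σ[ bF′ ∈ Σ (Fin k → ℕ) Frontier ] remaining (proj₁ bF′) < remaining (proj₁ bF)
  progress (b , F) with any? (λ i → b i <? m i)
  ... | no  none = inj₁ (λ i → ≮⇒≥ (none ∘ (i ,_)))
  ... | yes (_ , b<m) with forceable F b<m
  ...   | i , bᵢ<m , blueNext = inj₂ ((_ , advance F bᵢ<m blueNext) , remaining-advance b bᵢ<m)

  powerDominating : IsPowerDominating G ⁅ x ⁆
  powerDominating v with ∃-by-descent (remaining ∘ proj₁) progress (_ , initialFrontier) | cover v
  ... | (b , F) , finished | i , a , refl =
    Frontier.reached F i a (≤-trans (≤-pred (toℕ<n a)) (finished i))

  γP≡1 : PowerDomNumberIs G 1
  γP≡1 = (⁅ x ⁆ , powerDominating , ∣⁅x⁆∣≡1 x) , powerDominating⇒∣S∣≥1 G x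

module _ (G : Graph) where
  open Graph G

  ForcedBy : (Before : Fin n → Fin n → Set) → Fin n → Fin n → Set
  ForcedBy Before u v = Before u v × E G u v × (∀ w → E G u w → w ≢ v → Before w v)

  -- A complete forcing process started from {x}, one force per step: v turned
  -- blue at step time v, forced by forcer v; step 0 colours the closed
  -- neighbourhood of x.
  record Chronology (x : Fin n) : Set where
    field
      time    : Fin n → ℕ
      forcer  : Fin n → Fin n
      horizon : ℕ
      time≡0⇒initial : ∀ v → time v ≡ 0 → v ≡ x ⊎ E G x v
      initial⇒time≡0 : ∀ v → v ≡ x ⊎ E G x v → time v ≡ 0
      forced          : ∀ v → 0 < time v → ForcedBy (λ w v → time w < time v) (forcer v) v
      time≤horizon    : ∀ v → time v ≤ horizon

module ForcingProcess (G : Graph) (x : Fin (Graph.n G)) where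
  open Graph G

  record Partial : Set where
    field
      blue   : Fin n → Bool
      time   : Fin n → ℕ
      forcer : Fin n → Fin n
      now    : ℕ
      initial⇒blue   : ∀ v → v ≡ x ⊎ E G x v → blue v ≡ true × time v ≡ 0
      time≡0⇒initial : ∀ v → blue v ≡ true → time v ≡ 0 → v ≡ x ⊎ E G x v
      forced         : ∀ v → blue v ≡ true → 0 < time v →
                       ForcedBy G (λ w v → blue w ≡ true × time w < time v) (forcer v) v
      time≤now       : ∀ v → blue v ≡ true → time v ≤ now

  CanForce : (Fin n → Bool) → Fin n → Fin n → Set
  CanForce blue u v = blue u ≡ true × blue v ≡ false × E G u v × (∀ w → E G u w → w ≢ v → blue w ≡ true)

  canForce? : ∀ blue → Dec (∃[ u ] ∃[ v ] CanForce blue u v)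
  canForce? blue = any? λ u → any? λ v →
    (blue u ≟B true) ×-dec (blue v ≟B false) ×-dec (adj u v ≟B true) ×-dec
    all? (λ w → (adj u w ≟B true) →-dec (¬? (w ≟F v) →-dec (blue w ≟B true)))

  stuck⇒closed : ∀ {S} → (∀ y → y ∈ S → y ≡ x) → (st : Partial) →
                 ¬ (∃[ u ] ∃[ v ] CanForce (Partial.blue st) u v) →
                 ∀ {v} → Blue G S v → Partial.blue st v ≡ true
  stuck⇒closed S⊆x st stuck (inS {v} v∈S) =
    proj₁ (Partial.initial⇒blue st v (inj₁ (S⊆x v v∈S)))
  stuck⇒closed S⊆x st stuck (nbr {u} {v} u∈S Euv) =
    proj₁ (Partial.initial⇒blue st v (inj₂ (subst (λ z → E G z v) (S⊆x u u∈S) Euv)))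
  stuck⇒closed S⊆x st stuck (force {u} {v} bu Euv others) with Partial.blue st v in blueᵥ
  ... | true  = refl
  ... | false = ⊥-elim (stuck (u , v , stuck⇒closed S⊆x st stuck bu , blueᵥ , Euv ,
                               λ w Euw w≢v → stuck⇒closed S⊆x st stuck (others w Euw w≢v)))

  step : (st : Partial) → ∀ {u v} → CanForce (Partial.blue st) u v → Partial
  step st {u} {v} (blueᵤ , whiteᵥ , Euv , othersBlue) = record
    { blue = blue′ ; time = time′ ; forcer = forcer′ ; now = suc now
    ; initial⇒blue = initial⇒blue′ ; time≡0⇒initial = time≡0⇒initial′
    ; forced = forced′ ; time≤now = time≤now′ }
    where
    open Partial st
    blue′ : Fin n → Bool
    blue′ = updateAt blue v (const true)
    time′ : Fin n → ℕ
    time′ = updateAt time v (const (suc now))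
    forcer′ : Fin n → Fin n
    forcer′ = updateAt forcer v (const u)

    blue⇒≢v : ∀ {w} → blue w ≡ true → w ≢ v
    blue⇒≢v blue-w refl with trans (sym blue-w) whiteᵥ
    ... | ()

    unchanged : ∀ {A : Set} (f : Fin n → A) {a w} → blue w ≡ true → updateAt f v (const a) w ≡ f w
    unchanged f {w = w} blue-w = updateAt-minimal w v f (blue⇒≢v blue-w)

    keep : ∀ {w t} → blue w ≡ true × time w < t → blue′ w ≡ true × time′ w < t
    keep (blue-w , w<t) = trans (unchanged blue blue-w) blue-w , subst (_< _) (sym (unchanged time blue-w)) w<t

    beforeNew : ∀ {w} → blue w ≡ true → blue w ≡ true × time w < suc now
    beforeNew blue-w = blue-w , s≤s (time≤now _ blue-w)

    initial⇒blue′ : ∀ w → w ≡ x ⊎ E G x w → blue′ w ≡ true × time′ w ≡ 0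
    initial⇒blue′ w init with initial⇒blue w init
    ... | blue-w , t≡0 = trans (unchanged blue blue-w) blue-w , trans (unchanged time blue-w) t≡0

    time≡0⇒initial′ : ∀ w → blue′ w ≡ true → time′ w ≡ 0 → w ≡ x ⊎ E G x w
    time≡0⇒initial′ w blue-w t≡0 with w ≟F v
    ... | yes refl rewrite updateAt-updates v {const (suc now)} time with t≡0
    ...   | ()
    time≡0⇒initial′ w blue-w t≡0 | no w≢v
      rewrite updateAt-minimal w v {const true} blue w≢v | updateAt-minimal w v {const (suc now)} time w≢v
      = time≡0⇒initial w blue-w t≡0

    forced′ : ∀ w → blue′ w ≡ true → 0 < time′ w →
              ForcedBy G (λ w′ w → blue′ w′ ≡ true × time′ w′ < time′ w) (forcer′ w) w
    forced′ w _ _ with w ≟F v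
    ... | yes refl rewrite updateAt-updates v {const u} forcer | updateAt-updates v {const (suc now)} time =
      keep (beforeNew blueᵤ) , Euv , λ w′ Euw′ w′≢v → keep (beforeNew (othersBlue w′ Euw′ w′≢v))
    forced′ w blue-w 0<t | no w≢v
      rewrite updateAt-minimal w v {const true} blue w≢v | updateAt-minimal w v {const (suc now)} time w≢v
            | updateAt-minimal w v {const u} forcer w≢v
      with forced w blue-w 0<t
    ... | before , Efw , others = keep before , Efw , λ w′ E′ w′≢w → keep (others w′ E′ w′≢w)

    time≤now′ : ∀ w → blue′ w ≡ true → time′ w ≤ suc now
    time≤now′ w blue-w with w ≟F v
    ... | yes refl rewrite updateAt-updates v {const (suc now)} time = ≤-refl
    ... | no  w≢v  rewrite updateAt-minimal w v {const true} blue w≢v | updateAt-minimal w v {const (suc now)} time w≢v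
      = m≤n⇒m≤1+n (time≤now w blue-w)

  whites : (Fin n → Bool) → ℕ
  whites blue = ∑ λ w → if blue w then 0 else 1

  whites-step : (st : Partial) → ∀ {u v} (c : CanForce (Partial.blue st) u v) →
                whites (Partial.blue (step st c)) < whites (Partial.blue st)
  whites-step st {v = v} (_ , whiteᵥ , _) = ∑-mono-< fewer v newlyBlue
    where
    open Partial st
    fewer : ∀ w → (if updateAt blue v (const true) w then 0 else 1) ≤ (if blue w then 0 else 1)
    fewer w with w ≟F v
    ... | yes refl rewrite updateAt-updates v {const true} blue = z≤n
    ... | no  w≢v  rewrite updateAt-minimal w v {const true} blue w≢v = ≤-refl
    newlyBlue : (if updateAt blue v (const true) v then 0 else 1) < (if blue v then 0 else 1)
    newlyBlue rewrite updateAt-updates v {const true} blue | whiteᵥ = s≤s z≤n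

  initial : Partial
  initial = record
    { blue = blue₀ ; time = const 0 ; forcer = const x ; now = 0
    ; initial⇒blue = λ v init → initial⇒blue₀ v init , refl
    ; time≡0⇒initial = λ v blueᵥ _ → blue₀⇒initial v blueᵥ
    ; forced = λ _ _ () ; time≤now = λ _ _ → z≤n }
    where
    blue₀ : Fin n → Bool
    blue₀ w with w ≟F x
    ... | yes _ = true
    ... | no  _ = adj x w
    initial⇒blue₀ : ∀ w → w ≡ x ⊎ E G x w → blue₀ w ≡ true
    initial⇒blue₀ w init with w ≟F x | init
    ... | yes _   | _          = refl
    ... | no  w≢x | inj₁ w≡x   = ⊥-elim (w≢x w≡x)
    ... | no  _   | inj₂ Exw   = Exw
    blue₀⇒initial : ∀ w → blue₀ w ≡ true → w ≡ x ⊎ E G x w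
    blue₀⇒initial w blue-w with w ≟F x
    ... | yes w≡x = inj₁ w≡x
    ... | no  _   = inj₂ blue-w

  powerDominating⇒chronology : ∀ {S} → (∀ y → y ∈ S → y ≡ x) → IsPowerDominating G S → Chronology G x
  powerDominating⇒chronology S⊆x pd = record
    { time = time ; forcer = forcer ; horizon = now
    ; time≡0⇒initial = λ v → time≡0⇒initial v (allBlue v)
    ; initial⇒time≡0 = λ v → proj₂ ∘ initial⇒blue v
    ; forced = λ v 0<t → dropBlue (forced v (allBlue v) 0<t)
    ; time≤horizon = λ v → time≤now v (allBlue v) }
    where
    final : ∃ λ st → ¬ (∃[ u ] ∃[ v ] CanForce (Partial.blue st) u v)
    final = ∃-by-descent (whites ∘ Partial.blue) progress initial
      where
      progress : ∀ st → ¬ (∃[ u ] ∃[ v ] CanForce (Partial.blue st) u v) ⊎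
                        ∃[ st′ ] whites (Partial.blue st′) < whites (Partial.blue st)
      progress st with canForce? (Partial.blue st)
      ... | no  stuck       = inj₁ stuck
      ... | yes (u , v , c) = inj₂ (step st c , whites-step st c)
    open Partial (proj₁ final)
    allBlue : ∀ v → blue v ≡ true
    allBlue v = stuck⇒closed S⊆x (proj₁ final) (proj₂ final) (pd v)
    dropBlue : ∀ {u v} → ForcedBy G (λ w v → blue w ≡ true × time w < time v) u v →
               ForcedBy G (λ w v → time w < time v) u v
    dropBlue (before , Euv , others) = proj₂ before , Euv , λ w Euw w≢v → proj₂ (others w Euw w≢v)

module Chronology⇒ParallelPaths (G : Graph) {x : Fin (Graph.n G)} (C : Chronology G x) where
  open Graph G
  open Chronology C

  forcer-earlier : ∀ {v} → 0 < time v → time (forcer v) < time v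
  forcer-earlier 0<t = proj₁ (forced _ 0<t)

  forcer-adjacent : ∀ {v} → 0 < time v → E G (forcer v) v
  forcer-adjacent 0<t = proj₁ (proj₂ (forced _ 0<t))

  forcer-others-earlier : ∀ {v w} → 0 < time v → E G (forcer v) w → w ≢ v → time w < time v
  forcer-others-earlier 0<t = proj₂ (proj₂ (forced _ 0<t)) _

  forcer-injective : ∀ {v w} → 0 < time v → 0 < time w → forcer v ≡ forcer w → v ≡ w
  forcer-injective {v} {w} 0<tv 0<tw fv≡fw with v ≟F w
  ... | yes v≡w = v≡w
  ... | no  v≢w = ⊥-elim (<-asym
      (forcer-others-earlier 0<tw (subst (λ z → E G z v) fv≡fw (forcer-adjacent 0<tv)) v≢w)
      (forcer-others-earlier 0<tv (subst (λ z → E G z w) (sym fv≡fw) (forcer-adjacent 0<tw)) (v≢w ∘ sym)))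

  forcee? : ∀ u → Dec (∃[ v ] (0 < time v × forcer v ≡ u))
  forcee? u = any? (λ v → (0 <? time v) ×-dec (forcer v ≟F u))

  -- chain f u: u, the vertex u forced, the vertex that one forced, …, for at
  -- most f steps; f = horizon never cuts a chain short since times increase.
  chain : ℕ → Fin n → ℕ → Fin n
  chain _       u zero    = u
  chain zero    u (suc a) = u
  chain (suc f) u (suc a) with forcee? u
  ... | yes (v , _) = chain f v a
  ... | no  _       = u

  chainLength : ℕ → Fin n → ℕ
  chainLength zero    u = 0
  chainLength (suc f) u with forcee? u
  ... | yes (v , _) = suc (chainLength f v)
  ... | no  _       = 0

  chain-forced : ∀ f u {a} → a < chainLength f u →
                 0 < time (chain f u (suc a)) × forcer (chain f u (suc a)) ≡ chain f u a
  chain-forced (suc f) u {zero} _ with forcee? u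
  ... | yes (v , 0<t , fv≡u) = 0<t , fv≡u
  chain-forced (suc f) u {suc a} a<L with forcee? u
  ... | yes (v , _) = chain-forced f v (≤-pred a<L)

  chain-maximal : ∀ f u → horizon ≤ time u + f → ∀ {a} → a ≤ chainLength f u →
                  ∀ {v} → 0 < time v → forcer v ≡ chain f u a → a < chainLength f u × chain f u (suc a) ≡ v
  chain-maximal zero u h≤ {zero} _ 0<t fv≡u = ⊥-elim (<-irrefl refl (begin-strict
    horizon             ≤⟨ h≤ ⟩
    time u + 0          ≡⟨ +-identityʳ (time u) ⟩
    time u              ≡⟨ cong time (sym fv≡u) ⟩
    time (forcer _)     <⟨ forcer-earlier 0<t ⟩
    time _              ≤⟨ time≤horizon _ ⟩
    horizon             ∎))
    where open ≤-Reasoning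
  chain-maximal (suc f) u h≤ {zero} _ 0<t fv≡u with forcee? u
  ... | yes (v′ , 0<t′ , fv′≡u) = s≤s z≤n , forcer-injective 0<t′ 0<t (trans fv′≡u (sym fv≡u))
  ... | no  none                = ⊥-elim (none (_ , 0<t , fv≡u))
  chain-maximal (suc f) u h≤ {suc a} a≤L 0<t fv≡ with forcee? u
  ... | yes (v′ , 0<t′ , fv′≡u) = map₁ s≤s (chain-maximal f v′ h≤′ (≤-pred a≤L) 0<t fv≡)
    where
    h≤′ : horizon ≤ time v′ + f
    h≤′ = ≤-trans h≤ (≤-trans (≤-reflexive (+-suc (time u) f))
            (+-monoˡ-≤ f (subst (λ z → suc (time z) ≤ time v′) fv′≡u (forcer-earlier 0<t′))))

  chain-time-step : ∀ f u a → a < chainLength f u → time (chain f u a) < time (chain f u (suc a))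
  chain-time-step f u a a<L with chain-forced f u a<L
  ... | 0<t , forcer≡ = subst (λ z → time z < time (chain f u (suc a))) forcer≡ (forcer-earlier 0<t)

  chain-time-< : ∀ f u {a b} → a < b → b ≤ chainLength f u → time (chain f u a) < time (chain f u b)
  chain-time-< f u = stepwise⇒<-mono (time ∘ chain f u) (chain-time-step f u)

  chain-time-≤ : ∀ f u {a b} → a ≤ b → b ≤ chainLength f u → time (chain f u a) ≤ time (chain f u b)
  chain-time-≤ f u = stepwise⇒≤-mono (time ∘ chain f u) (chain-time-step f u)

  chain-time-pos : ∀ f u {a} → suc a ≤ chainLength f u → 0 < time (chain f u (suc a))
  chain-time-pos f u a<L = proj₁ (chain-forced f u a<L)

  time-x : time x ≡ 0
  time-x = initial⇒time≡0 x (inj₁ refl)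

  chain-≢x : ∀ {i a} → E G x i → a ≤ chainLength horizon i → chain horizon i a ≢ x
  chain-≢x {i} {zero}  Exi _   refl with trans (sym (irrefl i)) Exi
  ... | ()
  chain-≢x {i} {suc a} Exi a<L i≡x =
    <⇒≢ (chain-time-pos horizon i a<L) (sym (trans (cong time i≡x) time-x))

  -- Paths are indexed by all vertices; a non-neighbour of x indexes the
  -- trivial path consisting of x alone.
  pathLength : Fin n → ℕ
  pathLength i = if adj x i then suc (chainLength horizon i) else 0

  path : Fin n → ℕ → Fin n
  path i zero    = x
  path i (suc a) = chain horizon i a

  path-suc-bound : ∀ {i a} → suc a ≤ pathLength i → E G x i × a ≤ chainLength horizon i
  path-suc-bound {i} a<L with adj x i
  ... | true = refl , ≤-pred a<L

  pathLength-adjacent : ∀ {i} → E G x i → pathLength i ≡ suc (chainLength horizon i)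
  pathLength-adjacent Exi rewrite Exi = refl

  path-injective : ∀ {i a b} → a ≤ pathLength i → b ≤ pathLength i → path i a ≡ path i b → a ≡ b
  path-injective {a = zero}  {zero}  _   _   _  = refl
  path-injective {a = zero}  {suc b} _   b≤L eq = ⊥-elim (chain-≢x (proj₁ (path-suc-bound b≤L)) (proj₂ (path-suc-bound b≤L)) (sym eq))
  path-injective {a = suc a} {zero}  a≤L _   eq = ⊥-elim (chain-≢x (proj₁ (path-suc-bound a≤L)) (proj₂ (path-suc-bound a≤L)) eq)
  path-injective {i} {suc a} {suc b} a≤L b≤L eq with <-cmp a b
  ... | tri< a<b _ _ = ⊥-elim (<⇒≢ (chain-time-< horizon i a<b (proj₂ (path-suc-bound b≤L))) (cong time eq))
  ... | tri≈ _ a≡b _ = cong suc a≡b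
  ... | tri> _ _ b<a = ⊥-elim (<⇒≢ (chain-time-< horizon i b<a (proj₂ (path-suc-bound a≤L))) (cong time (sym eq)))

  path-adjacent : ∀ {i a} → suc a ≤ pathLength i → E G (path i a) (path i (suc a))
  path-adjacent {a = zero}      a<L = proj₁ (path-suc-bound a<L)
  path-adjacent {i} {a = suc a} a<L with chain-forced horizon i (proj₂ (path-suc-bound a<L))
  ... | 0<t , forcer≡ = subst (λ z → E G z (chain horizon i (suc a))) forcer≡ (forcer-adjacent 0<t)

  path-nonadjacent : ∀ {i a b} → suc (suc a) ≤ b → b ≤ pathLength i → ¬ E G (path i a) (path i b)
  path-nonadjacent {i} {zero} {suc b} (s≤s 1≤b) b≤L Exb =
    <⇒≢ (≤-<-trans z≤n (chain-time-< horizon i 1≤b (proj₂ (path-suc-bound b≤L))))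
        (sym (initial⇒time≡0 _ (inj₂ Exb)))
  path-nonadjacent {i} {suc a} {suc b} (s≤s a+1<b) b≤L Eab with chain-forced horizon i (≤-trans (<⇒≤ a+1<b) (proj₂ (path-suc-bound b≤L)))
  ... | 0<t , forcer≡ = <-asym next<b b<next
    where
    next<b : time (chain horizon i (suc a)) < time (chain horizon i b)
    next<b = chain-time-< horizon i a+1<b (proj₂ (path-suc-bound b≤L))
    b<next : time (chain horizon i b) < time (chain horizon i (suc a))
    b<next = forcer-others-earlier 0<t (subst (λ z → E G z (chain horizon i b)) (sym forcer≡) Eab)
               (λ b≡next → <⇒≢ next<b (cong time (sym b≡next)))

  path-induced : ∀ {i a b} → a ≤ pathLength i → b ≤ pathLength i →
                 (E G (path i a) (path i b) → (b ≡ suc a ⊎ a ≡ suc b)) ×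
                 ((b ≡ suc a ⊎ a ≡ suc b) → E G (path i a) (path i b))
  path-induced {i} {a} {b} a≤L b≤L = adjacent⇒consecutive , consecutive⇒adjacent
    where
    adjacent⇒consecutive : E G (path i a) (path i b) → (b ≡ suc a ⊎ a ≡ suc b)
    adjacent⇒consecutive Eab with <-cmp a b
    ... | tri≈ _ refl _ with trans (sym (irrefl (path i a))) Eab
    ...   | ()
    adjacent⇒consecutive Eab | tri< a<b _ _ with m≤n⇒m<n∨m≡n a<b
    ...   | inj₁ a+1<b = ⊥-elim (path-nonadjacent a+1<b b≤L Eab)
    ...   | inj₂ a+1≡b = inj₁ (sym a+1≡b)
    adjacent⇒consecutive Eab | tri> _ _ b<a with m≤n⇒m<n∨m≡n b<a
    ...   | inj₁ b+1<a = ⊥-elim (path-nonadjacent b+1<a a≤L (trans (symm (path i b) (path i a)) Eab))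
    ...   | inj₂ b+1≡a = inj₂ (sym b+1≡a)
    consecutive⇒adjacent : (b ≡ suc a ⊎ a ≡ suc b) → E G (path i a) (path i b)
    consecutive⇒adjacent (inj₁ refl) = path-adjacent b≤L
    consecutive⇒adjacent (inj₂ refl) = trans (symm (path i a) (path i b)) (path-adjacent a≤L)

  -- Walking back along forcer, both chains reach their starting vertices, the
  -- only ones of time 0, after the same number of steps.
  chain-root-unique : ∀ {i j a b} → E G x i → E G x j → a ≤ chainLength horizon i → b ≤ chainLength horizon j →
                      chain horizon i a ≡ chain horizon j b → i ≡ j
  chain-root-unique {a = zero} {zero} _ _ _ _ i≡j = i≡j
  chain-root-unique {i} {j} {zero} {suc b} Exi _ _ b<L i≡ =
    ⊥-elim (<⇒≢ (chain-time-pos horizon j b<L) (sym (trans (cong time (sym i≡)) (initial⇒time≡0 i (inj₂ Exi)))))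
  chain-root-unique {i} {j} {suc a} {zero} _ Exj a<L _ ≡j =
    ⊥-elim (<⇒≢ (chain-time-pos horizon i a<L) (sym (trans (cong time ≡j) (initial⇒time≡0 j (inj₂ Exj)))))
  chain-root-unique {i} {j} {suc a} {suc b} Exi Exj a<L b<L eq =
    chain-root-unique Exi Exj (<⇒≤ a<L) (<⇒≤ b<L)
      (trans (sym (proj₂ (chain-forced horizon i a<L))) (trans (cong forcer eq) (proj₂ (chain-forced horizon j b<L))))

  paths-meet-at-x : ∀ {i j a b} → i ≢ j → a ≤ pathLength i → b ≤ pathLength j → path i a ≡ path j b → path i a ≡ x
  paths-meet-at-x {a = zero}              _   _   _   _  = refl
  paths-meet-at-x {a = suc a} {zero}      _   _   _   eq = eq
  paths-meet-at-x {a = suc a} {suc b} i≢j a<L b<L eq with path-suc-bound a<L | path-suc-bound b<L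
  ... | Exi , a≤L | Exj , b≤L = ⊥-elim (i≢j (chain-root-unique Exi Exj a≤L b≤L eq))

  OnChain : Fin n → Set
  OnChain v = ∃[ i ] (E G x i × ∃[ a ] (a ≤ chainLength horizon i × chain horizon i a ≡ v))

  forcer-≢x : ∀ {v} → 0 < time v → forcer v ≢ x
  forcer-≢x {v} 0<t f≡x = <⇒≢ 0<t (sym (initial⇒time≡0 v (inj₂ (subst (λ z → E G z v) f≡x (forcer-adjacent 0<t)))))

  forcer-path-suc-bound⇒path-suc-bound : ∀ {v} → 0 < time v → OnChain (forcer v) → OnChain v
  forcer-path-suc-bound⇒path-suc-bound {v} 0<t (i , Exi , a , a≤L , chain≡f) =
    i , Exi , suc a , chain-maximal horizon i (m≤n+m horizon (time i)) a≤L 0<t (sym chain≡f)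

  chains-cover : ∀ v → v ≢ x → OnChain v
  chains-cover v = go (time v) v ≤-refl
    where
    go : ∀ t v → time v ≤ t → v ≢ x → OnChain v
    go t v tᵥ≤t v≢x with 0 <? time v
    ... | no tᵥ≮0 with time≡0⇒initial v (n≤0⇒n≡0 (≮⇒≥ tᵥ≮0))
    ...   | inj₁ v≡x = ⊥-elim (v≢x v≡x)
    ...   | inj₂ Exv = v , Exv , 0 , z≤n , refl
    go zero    v tᵥ≤0 v≢x | yes 0<tᵥ = ⊥-elim (<-irrefl refl (<-≤-trans 0<tᵥ tᵥ≤0))
    go (suc t) v tᵥ≤t v≢x | yes 0<tᵥ = forcer-path-suc-bound⇒path-suc-bound 0<tᵥ
      (go t (forcer v) (≤-pred (≤-trans (forcer-earlier 0<tᵥ) tᵥ≤t)) (forcer-≢x 0<tᵥ))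

  paths-cover : ∀ v → ∃[ i ] ∃[ a ] (a ≤ pathLength i × path i a ≡ v)
  paths-cover v with v ≟F x
  ... | yes v≡x = v , 0 , z≤n , sym v≡x
  ... | no  v≢x with chains-cover v v≢x
  ...   | i , Exi , a , a≤L , chain≡v = i , suc a , ≤-trans (s≤s a≤L) (≤-reflexive (sym (pathLength-adjacent Exi))) , chain≡v

  -- The forcing argument in reverse: path i P forced path i (1 + P), so every
  -- other neighbour of it was blue earlier, hence lies no later than p on path j.
  successor-only-later-neighbour :
    ∀ {i P j p q} → 0 < P → P < pathLength i → p < q → q ≤ pathLength j →
    time (path i (suc P)) ≤ time (path j (suc p)) → E G (path i P) (path j q) → path j q ≡ path i (suc P)
  successor-only-later-neighbour {i} {suc P} {j} {p} {suc q} _ P<L (s≤s p≤q) q≤L t≤t E₁ with path j (suc q) ≟F path i (suc (suc P))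
  ... | yes eq = eq
  ... | no  ≢next with chain-forced horizon i (proj₂ (path-suc-bound P<L))
  ...   | 0<t , forcer≡ = ⊥-elim (<-irrefl refl (begin-strict
    time (chain horizon j q)         <⟨ forcer-others-earlier 0<t (subst (λ z → E G z (chain horizon j q)) (sym forcer≡) E₁) ≢next ⟩
    time (chain horizon i (suc P))   ≤⟨ t≤t ⟩
    time (chain horizon j p)         ≤⟨ chain-time-≤ horizon j p≤q (proj₂ (path-suc-bound q≤L)) ⟩
    time (chain horizon j q)         ∎))
    where open ≤-Reasoning

  bounded : ∀ {m} (a : Fin (suc m)) → toℕ a ≤ m
  bounded a = ≤-pred (toℕ<n a)

  -- Of the selected paths, take one whose next vertex was forced earliest.
  parallel-condition :
    (sel : (i : Fin n) → Maybe (Fin (suc (pathLength i)))) →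
    (∃[ i ] ∃[ p ] sel i ≡ just p) →
    (∀ i p → sel i ≡ just p → 0 < toℕ p × toℕ p < pathLength i) →
    let Y : Fin n → Set
        Y y = ∃[ i ] ∃[ p ] ∃[ q ] (sel i ≡ just p × toℕ p < toℕ q × path i (toℕ q) ≡ y)
    in ∃[ i ] ∃[ p ] (sel i ≡ just p ×
         (∃[ y ] (Y y × E G (path i (toℕ p)) y × (∀ z → Y z → E G (path i (toℕ p)) z → z ≡ y))))
  parallel-condition sel nonempty internal with argmin selected? nextTime nonempty
    where
    selected? : Decidable (λ i → ∃[ p ] sel i ≡ just p)
    selected? i with sel i
    ... | just p  = yes (p , refl)
    ... | nothing = no λ ()
    nextTime : Fin n → ℕ
    nextTime i = maybe (λ p → time (path i (suc (toℕ p)))) 0 (sel i)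
  ... | i , (p , selᵢ) , earliest with internal i p selᵢ
  ...   | 0<p , p<L =
    i , p , selᵢ , path i (suc (toℕ p)) ,
    (i , p , next , selᵢ , ≤-reflexive (sym next≡) , cong (path i) next≡) ,
    path-adjacent p<L , onlyNext
    where
    next : Fin (suc (pathLength i))
    next = fromℕ< (s≤s p<L)
    next≡ : toℕ next ≡ suc (toℕ p)
    next≡ = toℕ-fromℕ< (s≤s p<L)
    nextTime-selected : ∀ {j p} → sel j ≡ just p → maybe (λ p → time (path j (suc (toℕ p)))) 0 (sel j) ≡ time (path j (suc (toℕ p)))
    nextTime-selected eq rewrite eq = refl
    onlyNext : ∀ z → (∃[ j ] ∃[ p′ ] ∃[ q ] (sel j ≡ just p′ × toℕ p′ < toℕ q × path j (toℕ q) ≡ z)) →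
               E G (path i (toℕ p)) z → z ≡ path i (suc (toℕ p))
    onlyNext z (j , p′ , q , selⱼ , p′<q , refl) E₁ =
      successor-only-later-neighbour 0<p p<L p′<q (bounded q)
        (subst₂ _≤_ (nextTime-selected selᵢ) (nextTime-selected selⱼ) (earliest j (p′ , selⱼ))) E₁

  parallelPaths : InternallyParallelPaths G n
  parallelPaths = record
    { x        = x
    ; m        = pathLength
    ; Q        = λ i a → path i (toℕ a)
    ; start    = λ _ → refl
    ; simple   = λ i a b eq → toℕ-injective (path-injective (bounded a) (bounded b) eq)
    ; induced  = λ i a b → path-induced (bounded a) (bounded b)
    ; disjoint = λ i j a b i≢j → paths-meet-at-x i≢j (bounded a) (bounded b)
    ; cover    = cover
    ; parallel = parallel-condition }
    where
    cover : ∀ v → ∃[ i ] ∃[ a ] path i (toℕ {suc (pathLength i)} a) ≡ v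
    cover v with paths-cover v
    ... | i , a , a≤L , path≡v = i , fromℕ< (s≤s a≤L) , trans (cong (path i) (toℕ-fromℕ< (s≤s a≤L))) path≡v

theorem5p2 : (G : Graph) →
    (PowerDomNumberIs G 1 → ∃[ k ] InternallyParallelPaths G k) ×
    ((∃[ k ] InternallyParallelPaths G k) → PowerDomNumberIs G 1)
theorem5p2 G = γP≡1⇒parallelPaths , λ (k , R) → ParallelPaths⇒PowerDominating.γP≡1 G R
  where
  γP≡1⇒parallelPaths : PowerDomNumberIs G 1 → ∃[ k ] InternallyParallelPaths G k
  γP≡1⇒parallelPaths ((S , pd , ∣S∣≡1) , _) with ∣S∣≡1⇒singleton S ∣S∣≡1
  ... | x , _ , S⊆x = _ , Chronology⇒ParallelPaths.parallelPaths G
                            (ForcingProcess.powerDominating⇒chronology G x S⊆x pd)
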